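{- Let $\mathcal{R}$ be any rule set with $\{(\Box,\Box),(\Box,\ast)\}\subseteq\mathcal{R}$. Urzyczyn's pure $\lambda$-term $\mathsf{U}=(\lambda r.\,h\,(r\,(\lambda f.\lambda s.\,f\,s))\,(r\,(\lambda q.\lambda g.\,g\,q)))\,(\lambda o.\,o\,o\,o)$ is typable in the $\mathfrak{f}$-cube system $\vdash^{\mathcal R}$, i.e. there exist a context $\Delta$ and terms $A,B$ with $\Delta\vdash^{\mathcal R}A:B$, $\Delta\vdash^{\mathcal R}B:\ast$, and $\mathrm{TE}(A)=\mathsf{U}$.
   Context: Sorts $\ast,\Box$; variables $x^\varsigma$ are marked with a sort $\varsigma$; pure $\lambda$-term variables are the variables of sort $\ast$. Terms: $X::=\ast\mid\Box\mid x\mid \pi\,x\rho{:}X.\,Y\mid X\,Y$ with $\pi\in\{\lambda,\Pi\}$ and restriction $\rho=\overline{\in}\{X_1,\dots,X_i\}$, $i\ge0$; $\diamond=\overline{\in}\{\}$. Contexts are finite sequences of declarations $x\rho{:}X$; $\mathrm{rdec}(\Delta)$ is the sequence of pairs $x\rho$ for declarations of $\Delta$ with $\rho\neq\diamond$. $\beta$ is the compatible closure of $(\lambda x\rho{:}X.Y)Z\to Y[x:=Z]$; $=_\beta$ its equivalence closure. Restriction satisfaction $\Gamma\Vdash Y\rho$: (ref) $\varepsilon\Vdash Y\,\overline{\in}\{X_1,\dots,X_n\}$ if $Y=_\beta X_i$ for some $i$; (ctR) if $x\notin\mathrm{dom}(\Gamma)$ and for all $i\in1..n$, $\Gamma[x:=X_i]\Vdash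 Y[x:=X_i]\,\rho[x:=X_i]$, then $(x\,\overline{\in}\{X_1,\dots,X_n\}),\Gamma\Vdash Y\rho$. Typing rules of $\vdash^{\mathcal R}$ ($\mathcal R$ a set of pairs of sorts containing $(\ast,\ast)$): (axiom) $\varepsilon\vdash\ast:\Box$; (weak) from $\Delta,\delta\vdash X:Y$ and $\Delta\vdash Z:W$ infer $\Delta,\delta\vdash Z:W$; (start) if $x^\varsigma\notin\mathrm{dom}(\Delta)$, $\Delta\vdash X:\varsigma$ and, for $\rho=\overline{\in}\{Y_1,\dots,Y_n\}$, $\Delta\vdash Y_j:X$ for all $j$, then $\Delta,x^\varsigma\rho{:}X\vdash x^\varsigma:X$; ($\Pi$) from $\Delta,x\rho{:}X\vdash Y:\varsigma$, $\Delta\vdash X:\varsigma'$, $(\varsigma',\varsigma)\in\mathcal R$ infer $\Delta\vdash\Pi x\rho{:}X.Y:\varsigma$; ($\lambda$) from $\Delta,\delta\vdash Y':Y$ and $\Delta\vdash\Pi\delta.Y:\varsigma$ infer $\Delta\vdash\lambda\delta.Y':\Pi\delta.Y$; (app) from $\Delta\vdash Z:\Pi x\rho{:}X.Y$, $\Delta\vdash W:X$ and (if $\rho\ne\diamond$) $\mathrm{rdec}(\Delta)\Vdash W\rho$ infer $\Delta\vdash ZW:Y[x:=W]$; (conv) from $\Delta\vdash X:Y$, $\Delta\vdash Z:\varsigma$, $\mathrm{rdec}(\Delta)\Vdash Y\,\overline{\in}\{Z\}$ infer $\Delta\vdash X:Z$. Degree: $\sharp(\Box)=3,\sharp(\ast)=2,\sharp(x^\varsigma)=\sharp(\varsigma)-2$,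 $\sharp(\pi\delta.X)=\sharp(XY)=\sharp(X)$. Type erasure $\mathrm{TE}$ is the smallest (partial) function from terms to pure $\lambda$-terms with $\mathrm{TE}(x)=x$; $\mathrm{TE}(XY)=\mathrm{TE}(X)\,\mathrm{TE}(Y)$ if $\sharp(Y)=0$; $\mathrm{TE}(XY)=\mathrm{TE}(X)$ if $\sharp(Y)=1$; $\mathrm{TE}(\lambda x^\ast\rho{:}X.Y)=\lambda x^\ast.\mathrm{TE}(Y)$; $\mathrm{TE}(\lambda x^\Box\rho{:}X.Y)=\mathrm{TE}(Y)$. Pure $\lambda$-terms are taken up to $\alpha$-conversion. -}

module Defs where

open import Data.Nat using (ℕ; zero; suc; _∸_; _<ᵇ_; _≡ᵇ_)
open import Data.Bool using (Bool; true; false; if_then_else_; _∧_)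
open import Data.List using (List; []; _∷_; _++_; [_]; _∷ʳ_)
import Data.List as L
open import Data.List.Membership.Propositional using (_∈_; _∉_)
open import Data.List.Relation.Unary.Any using (Any)
open import Data.Maybe using (Maybe; just; nothing; _>>=_)
import Data.Maybe as M
open import Data.Product using (_×_; _,_; proj₁)
open import Relation.Binary.PropositionalEquality using (_≡_; _≢_)
open import Relation.Binary.Construct.Closure.Equivalence using (EqClosure)

-- Syntax (locally nameless: bound variables are de Bruijn indices,
-- free variables are names x^ς, i.e. a sort together with a ℕ-name).

data Sort : Set where
  star box : Sort

data Binder : Set where
  lam pi : Binder

Var : Set
Var = Sort × ℕ

-- bind π ς ρ X Y  represents  π x^ς ρ : X . Y  (x bound in Y only);
-- the restriction ρ = ∈̄{X₁,…,Xᵢ} is the list [X₁,…,Xᵢ], ◇ = [].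
data Term : Set where
  srt  : Sort → Term
  fv   : Var → Term
  bv   : ℕ → Term
  bind : Binder → Sort → List Term → Term → Term → Term
  app  : Term → Term → Term

sortEq : Sort → Sort → Bool
sortEq star star = true
sortEq box  box  = true
sortEq _    _    = false

varEq : Var → Var → Bool
varEq (s , x) (t , y) = sortEq s t ∧ (x ≡ᵇ y)

mutual
  shift : ℕ → Term → Term
  shift c (srt s) = srt s
  shift c (fv x) = fv x
  shift c (bv i) = if i <ᵇ c then bv i else bv (suc i)
  shift c (bind b s ρ X Y) = bind b s (shiftL c ρ) (shift c X) (shift (suc c) Y)
  shift c (app X Y) = app (shift c X) (shift c Y)

  shiftL : ℕ → List Term → List Term
  shiftL c [] = []
  shiftL c (t ∷ ts) = shift c t ∷ shiftL c ts

mutual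
  sub : ℕ → Term → Term → Term
  sub c u (srt s) = srt s
  sub c u (fv x) = fv x
  sub c u (bv i) = if i <ᵇ c then bv i else (if i ≡ᵇ c then u else bv (i ∸ 1))
  sub c u (bind b s ρ X Y) = bind b s (subL c u ρ) (sub c u X) (sub (suc c) (shift 0 u) Y)
  sub c u (app X Y) = app (sub c u X) (sub c u Y)

  subL : ℕ → Term → List Term → List Term
  subL c u [] = []
  subL c u (t ∷ ts) = sub c u t ∷ subL c u ts

inst : Term → Term → Term
inst Y u = sub 0 u Y

mutual
  substF : Var → Term → Term → Term
  substF x u (srt s) = srt s
  substF x u (fv y) = if varEq x y then u else fv y
  substF x u (bv i) = bv i
  substF x u (bind b s ρ X Y) = bind b s (substFL x u ρ) (substF x u X) (substF x (shift 0 u) Y)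
  substF x u (app X Y) = app (substF x u X) (substF x u Y)

  substFL : Var → Term → List Term → List Term
  substFL x u [] = []
  substFL x u (t ∷ ts) = substF x u t ∷ substFL x u ts

mutual
  fvs : Term → List Var
  fvs (srt s) = []
  fvs (fv x) = [ x ]
  fvs (bv i) = []
  fvs (bind b s ρ X Y) = fvsL ρ ++ fvs X ++ fvs Y
  fvs (app X Y) = fvs X ++ fvs Y

  fvsL : List Term → List Var
  fvsL [] = []
  fvsL (t ∷ ts) = fvs t ++ fvsL ts

mutual
  data _⟶β_ : Term → Term → Set where
    beta  : ∀ {s ρ X Y Z} → app (bind lam s ρ X Y) Z ⟶β inst Y Z
    appL  : ∀ {X X' Y} → X ⟶β X' → app X Y ⟶β app X' Y
    appR  : ∀ {X Y Y'} → Y ⟶β Y' → app X Y ⟶β app X Y'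
    bindρ : ∀ {b s ρ ρ' X Y} → ρ ⟶βL ρ' → bind b s ρ X Y ⟶β bind b s ρ' X Y
    bindX : ∀ {b s ρ X X' Y} → X ⟶β X' → bind b s ρ X Y ⟶β bind b s ρ X' Y
    bindY : ∀ {b s ρ X Y Y'} → Y ⟶β Y' → bind b s ρ X Y ⟶β bind b s ρ X Y'

  data _⟶βL_ : List Term → List Term → Set where
    here  : ∀ {t t' ts} → t ⟶β t' → (t ∷ ts) ⟶βL (t' ∷ ts)
    there : ∀ {t ts ts'} → ts ⟶βL ts' → (t ∷ ts) ⟶βL (t ∷ ts')

_=β_ : Term → Term → Set
_=β_ = EqClosure _⟶β_

-- Contexts (first element = leftmost declaration)

record Decl : Set where
  constructor dec
  field
    var : Var
    res : List Term
    ty  : Term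

Ctx : Set
Ctx = List Decl

dom : Ctx → List Var
dom = L.map Decl.var

RDec : Set
RDec = List (Var × List Term)

rdec : Ctx → RDec
rdec [] = []
rdec (dec x [] X ∷ Δ) = rdec Δ
rdec (dec x (r ∷ rs) X ∷ Δ) = (x , r ∷ rs) ∷ rdec Δ

substPair : Var → Term → Var × List Term → Var × List Term
substPair x u (y , ρ) = y , substFL x u ρ

substR : Var → Term → RDec → RDec
substR x u = L.map (substPair x u)

data _⊩_∈̄_ : RDec → Term → List Term → Set where
  ref : ∀ {Y ρ} → Any (Y =β_) ρ → [] ⊩ Y ∈̄ ρ
  ctR : ∀ {x Xs Γ Y ρ} → x ∉ L.map proj₁ Γ
      → (∀ {X} → X ∈ Xs → substR x X Γ ⊩ substF x X Y ∈̄ substFL x X ρ)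
      → ((x , Xs) ∷ Γ) ⊩ Y ∈̄ ρ

module Typing (R : Sort → Sort → Set) where

  data _⊢_∶_ : Ctx → Term → Term → Set where
    t-axiom : [] ⊢ srt star ∶ srt box
    t-weak  : ∀ {Δ δ X Y Z W} → (Δ ∷ʳ δ) ⊢ X ∶ Y → Δ ⊢ Z ∶ W → (Δ ∷ʳ δ) ⊢ Z ∶ W
    t-start : ∀ {Δ s x ρ X} → (s , x) ∉ dom Δ → Δ ⊢ X ∶ srt s
            → (∀ {Y} → Y ∈ ρ → Δ ⊢ Y ∶ X)
            → (Δ ∷ʳ dec (s , x) ρ X) ⊢ fv (s , x) ∶ X
    t-pi    : ∀ {Δ s x ρ X Y ς ς'} → (s , x) ∉ fvs Y
            → (Δ ∷ʳ dec (s , x) ρ X) ⊢ inst Y (fv (s , x)) ∶ srt ς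
            → Δ ⊢ X ∶ srt ς' → R ς' ς
            → Δ ⊢ bind pi s ρ X Y ∶ srt ς
    t-lam   : ∀ {Δ s x ρ X Y Y' ς} → (s , x) ∉ fvs Y' → (s , x) ∉ fvs Y
            → (Δ ∷ʳ dec (s , x) ρ X) ⊢ inst Y' (fv (s , x)) ∶ inst Y (fv (s , x))
            → Δ ⊢ bind pi s ρ X Y ∶ srt ς
            → Δ ⊢ bind lam s ρ X Y' ∶ bind pi s ρ X Y
    t-app   : ∀ {Δ s ρ X Y Z W} → Δ ⊢ Z ∶ bind pi s ρ X Y → Δ ⊢ W ∶ X
            → (ρ ≢ [] → rdec Δ ⊩ W ∈̄ ρ)
            → Δ ⊢ app Z W ∶ inst Y W
    t-conv  : ∀ {Δ X Y Z ς} → Δ ⊢ X ∶ Y → Δ ⊢ Z ∶ srt ς → rdec Δ ⊩ Y ∈̄ [ Z ]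
            → Δ ⊢ X ∶ Z

-- ♯(x^ς) = ♯(ς) - 2
vdeg : Sort → ℕ
vdeg star = 0
vdeg box  = 1

lookupS : List Sort → ℕ → Maybe Sort
lookupS [] i = nothing
lookupS (s ∷ e) zero = just s
lookupS (s ∷ e) (suc i) = lookupS e i

-- degree, relative to the sorts of the enclosing binders (innermost first)
deg : List Sort → Term → Maybe ℕ
deg e (srt star) = just 2
deg e (srt box) = just 3
deg e (fv (s , x)) = just (vdeg s)
deg e (bv i) = M.map vdeg (lookupS e i)
deg e (bind b s ρ X Y) = deg (s ∷ e) Y
deg e (app X Y) = deg e X

-- pure λ-terms (locally nameless, hence up to α); pfv n is the variable n^∗
data PTerm : Set where
  pfv  : ℕ → PTerm
  pbv  : ℕ → PTerm
  plam : PTerm → PTerm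
  papp : PTerm → PTerm → PTerm

-- index of a bound ∗-variable once the □-binders are erased
starIndex : List Sort → ℕ → Maybe ℕ
starIndex [] i = nothing
starIndex (star ∷ e) zero = just 0
starIndex (box ∷ e) zero = nothing
starIndex (star ∷ e) (suc i) = M.map suc (starIndex e i)
starIndex (box ∷ e) (suc i) = starIndex e i

teApp : Maybe ℕ → Maybe PTerm → Maybe PTerm → Maybe PTerm
teApp (just 0) mx my = mx >>= λ x → my >>= λ y → just (papp x y)
teApp (just 1) mx my = mx
teApp _ mx my = nothing

te : List Sort → Term → Maybe PTerm
te e (srt s) = nothing
te e (fv (star , x)) = just (pfv x)
te e (fv (box , x)) = nothing
te e (bv i) = M.map pbv (starIndex e i)
te e (bind lam star ρ X Y) = M.map plam (te (star ∷ e) Y)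
te e (bind lam box ρ X Y) = te (box ∷ e) Y
te e (bind pi s ρ X Y) = nothing
te e (app X Y) = teApp (deg e Y) (te e X) (te e Y)

TE : Term → Maybe PTerm
TE = te []

-- Urzyczyn's term, with h the free variable 0^∗
-- (λr. h (r (λf.λs. f s)) (r (λq.λg. g q))) (λo. o o o)

U : PTerm
U = papp (plam (papp (papp (pfv 0)
                            (papp (pbv 0) (plam (plam (papp (pbv 1) (pbv 0))))))
                      (papp (pbv 0) (plam (plam (papp (pbv 0) (pbv 1)))))))
         (plam (papp (papp (pbv 0) (pbv 0)) (pbv 0)))

{-# OPTIONS --safe #-}
module Submission where

open import Defs
open import Data.Product using (Σ; _×_)
open import Data.Maybe using (just)
open import Relation.Binary.PropositionalEquality using (_≡_)

open import Data.Nat using (ℕ; zero; suc; _+_; _⊔_)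
import Data.Nat as ℕ
open import Data.Bool using (if_then_else_)
open import Data.List using (List; []; _∷_; [_]; _∷ʳ_; length)
import Data.List as List
open import Data.List.Membership.Propositional using (_∈_; _∉_)
open import Data.List.Membership.DecPropositional using (_∉?_)
open import Data.List.Relation.Unary.Any using (Any; here; there)
open import Data.List.Relation.Unary.All using (All)
import Data.List.Relation.Unary.All as All
open import Data.Maybe using (Maybe; nothing; _>>=_; from-just)
import Data.Maybe as Maybe
open import Data.Maybe.Effectful using (applicative)
open import Data.Product using (_,_; proj₁)
import Data.Product.Properties as Product
open import Data.Empty using (⊥-elim)
open import Data.Unit using (⊤; tt)
open import Function using (const)
open import Level using (0ℓ)
open import Relation.Binary.Definitions using (DecidableEquality)
open import Relation.Binary.PropositionalEquality using (_≢_; refl; sym; subst; subst₂; cong)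
open import Relation.Binary.Construct.Closure.ReflexiveTransitive using (Star; ε; _◅_; _◅◅_)
import Relation.Binary.Construct.Closure.ReflexiveTransitive as Star
open import Relation.Binary.Construct.Closure.Symmetric using (fwd)
import Relation.Binary.Construct.Closure.Equivalence as EqClosure
open import Relation.Nullary using (yes; no)
open import Relation.Nullary.Decidable using (dec⇒maybe)

-- Give r the type  Π α ∈̄ {K₁, K₂} : ⋆ → ⋆ → ⋆. O α → α T₁ T₂,  where K₁ = λx y. x,
-- K₂ = λx y. y  and  O α = Π β γ : ⋆. α ((β → γ) → β → γ) (β → (β → γ) → γ).  Then O K₁ and
-- O K₂ are the polymorphic types of λf.λs. f s and λq.λg. g q, and h (r K₁ …) (r K₂ …) is
-- typable.  The argument λo. o o o is typed with the restricted α still abstract: each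
-- occurrence of o is converted to a type α A B, and restriction satisfaction checks the
-- conversion separately for α := K₁ and α := K₂, where it is a β-equality of simple types.

_≟ˢ_ : DecidableEquality Sort
star ≟ˢ star = yes refl
box  ≟ˢ box  = yes refl
star ≟ˢ box  = no λ ()
box  ≟ˢ star = no λ ()

_≟ᵛ_ : DecidableEquality Var
_≟ᵛ_ = Product.≡-dec _≟ˢ_ ℕ._≟_

_≟ᵇ_ : DecidableEquality Binder
lam ≟ᵇ lam = yes refl
pi  ≟ᵇ pi  = yes refl
lam ≟ᵇ pi  = no λ ()
pi  ≟ᵇ lam = no λ ()

-- Semi-decisions: `nothing' only means that no proof was found.
_∉?ᵛ_ : (x : Var) (xs : List Var) → Maybe (x ∉ xs)
x ∉?ᵛ xs = dec⇒maybe (_∉?_ _≟ᵛ_ x xs)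

mutual
  _≟ᵗ_ : (a b : Term) → Maybe (a ≡ b)
  srt a ≟ᵗ srt b = Maybe.map (cong srt) (dec⇒maybe (a ≟ˢ b))
  fv x ≟ᵗ fv y = Maybe.map (cong fv) (dec⇒maybe (x ≟ᵛ y))
  bv i ≟ᵗ bv j = Maybe.map (cong bv) (dec⇒maybe (i ℕ.≟ j))
  bind b s ρ X Y ≟ᵗ bind b′ s′ ρ′ X′ Y′ = do
    refl ← dec⇒maybe (b ≟ᵇ b′)
    refl ← dec⇒maybe (s ≟ˢ s′)
    refl ← ρ ≟ᵗˢ ρ′
    refl ← X ≟ᵗ X′
    refl ← Y ≟ᵗ Y′
    just refl
  app X Y ≟ᵗ app X′ Y′ = do
    refl ← X ≟ᵗ X′
    refl ← Y ≟ᵗ Y′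
    just refl
  _ ≟ᵗ _ = nothing

  _≟ᵗˢ_ : (as bs : List Term) → Maybe (as ≡ bs)
  [] ≟ᵗˢ [] = just refl
  (a ∷ as) ≟ᵗˢ (b ∷ bs) = do
    refl ← a ≟ᵗ b
    refl ← as ≟ᵗˢ bs
    just refl
  _ ≟ᵗˢ _ = nothing

searchAny : {A : Set} {P : A → Set} → ((x : A) → Maybe (P x)) → (xs : List A) → Maybe (Any P xs)
searchAny p? [] = nothing
searchAny p? (x ∷ xs) with p? x
... | just px = just (here px)
... | nothing = Maybe.map there (searchAny p? xs)

searchAll : {A : Set} {P : A → Set} → ((x : A) → Maybe (P x)) → (xs : List A) → Maybe (All P xs)
searchAll p? xs = All.sequenceA 0ℓ applicative (All.universal p? xs)

mutual
  stepβ : (t : Term) → Maybe (Σ Term (t ⟶β_))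
  stepβ (app (bind lam s ρ X Y) Z) = just (inst Y Z , beta)
  stepβ (app X Y) with stepβ X
  ... | just (X′ , r) = just (app X′ Y , appL r)
  ... | nothing with stepβ Y
  ... | just (Y′ , r) = just (app X Y′ , appR r)
  ... | nothing = nothing
  stepβ (bind b s ρ X Y) with stepβs ρ
  ... | just (ρ′ , r) = just (bind b s ρ′ X Y , bindρ r)
  ... | nothing with stepβ X
  ... | just (X′ , r) = just (bind b s ρ X′ Y , bindX r)
  ... | nothing with stepβ Y
  ... | just (Y′ , r) = just (bind b s ρ X Y′ , bindY r)
  ... | nothing = nothing
  stepβ _ = nothing

  stepβs : (ts : List Term) → Maybe (Σ (List Term) (ts ⟶βL_))
  stepβs [] = nothing
  stepβs (t ∷ ts) with stepβ t
  ... | just (t′ , r) = just (t′ ∷ ts , here r)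
  ... | nothing with stepβs ts
  ... | just (ts′ , r) = just (t ∷ ts′ , there r)
  ... | nothing = nothing

reduceβ : ℕ → (t : Term) → Σ Term (Star _⟶β_ t)
reduceβ zero t = t , ε
reduceβ (suc n) t with stepβ t
... | nothing = t , ε
... | just (t′ , r) with reduceβ n t′
... | u , rs = u , r ◅ rs

⟶β*⇒=β : {a b : Term} → Star _⟶β_ a b → a =β b
⟶β*⇒=β = Star.map fwd

=β? : (fuel : ℕ) (a b : Term) → Maybe (a =β b)
=β? fuel a b with reduceβ fuel a | reduceβ fuel b
... | u , a↠u | v , b↠v = do
  refl ← u ≟ᵗ v
  just (⟶β*⇒=β a↠u ◅◅ EqClosure.symmetric _⟶β_ (⟶β*⇒=β b↠v))

-- ctR keeps the length of Γ, so `length Γ' is enough depth.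
satisfies? : (fuel depth : ℕ) (Γ : RDec) (Y : Term) (ρ : List Term) → Maybe (Γ ⊩ Y ∈̄ ρ)
satisfies? fuel _ [] Y ρ = Maybe.map ref (searchAny (=β? fuel Y) ρ)
satisfies? fuel zero (_ ∷ _) Y ρ = nothing
satisfies? fuel (suc depth) ((x , Xs) ∷ Γ) Y ρ = do
  x-fresh ← x ∉?ᵛ List.map proj₁ Γ
  cases ← searchAll (λ X → satisfies? fuel depth (substR x X Γ) (substF x X Y) (substFL x X ρ)) Xs
  just (ctR x-fresh (All.lookup cases))

data ATerm : Set where
  asrt  : Sort → ATerm
  afv   : Var → ATerm
  api   : Var → List ATerm → ATerm → ATerm → ATerm
  alam  : Var → List ATerm → ATerm → ATerm → ATerm → ATerm
  aapp  : ATerm → ATerm → ATerm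
  acast : ATerm → ATerm → ATerm

mutual
  close : Var → ℕ → Term → Term
  close x k (srt s) = srt s
  close x k (fv y) = if varEq x y then bv k else fv y
  close x k (bv i) = bv i
  close x k (bind b s ρ X Y) = bind b s (closes x k ρ) (close x k X) (close x (suc k) Y)
  close x k (app X Y) = app (close x k X) (close x k Y)

  closes : Var → ℕ → List Term → List Term
  closes x k [] = []
  closes x k (t ∷ ts) = close x k t ∷ closes x k ts

-- `alam x ρ X M T' is λx ρ : X. M annotated with the type T of M, and `acast M T' asks
-- for the conversion rule from the inferred type of M to T.
mutual
  erase : ATerm → Term
  erase (asrt s) = srt s
  erase (afv x) = fv x
  erase (api x ρ X Y) = bind pi (proj₁ x) (erases ρ) (erase X) (close x 0 (erase Y))
  erase (alam x ρ X M T) = bind lam (proj₁ x) (erases ρ) (erase X) (close x 0 (erase M))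
  erase (aapp M N) = app (erase M) (erase N)
  erase (acast M T) = erase M

  erases : List ATerm → List Term
  erases [] = []
  erases (t ∷ ts) = erase t ∷ erases ts

bindable? : (x : Var) (t : Term) → Maybe (inst (close x 0 t) (fv x) ≡ t × x ∉ fvs (close x 0 t))
bindable? x t = do
  reopens ← inst (close x 0 t) (fv x) ≟ᵗ t
  fresh ← x ∉?ᵛ fvs (close x 0 t)
  just (reopens , fresh)

data ADecl : Set where
  adec : Var → List ATerm → ATerm → ADecl

eraseDecl : ADecl → Decl
eraseDecl (adec x ρ X) = dec x (erases ρ) (erase X)

infixl 4 _▸_

data SnocCtx : Set where
  ∅   : SnocCtx
  _▸_ : SnocCtx → ADecl → SnocCtx

⟦_⟧ : SnocCtx → Ctx
⟦ ∅ ⟧ = []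
⟦ Γ ▸ d ⟧ = ⟦ Γ ⟧ ∷ʳ eraseDecl d

module Checker (R : Sort → Sort → Set) (R? : (s s′ : Sort) → Maybe (R s s′)) (fuel : ℕ) where
  open Typing R

  WellFormed : SnocCtx → Set
  WellFormed ∅ = ⊤
  WellFormed (Γ ▸ adec x ρ X) = WellFormed Γ × ⟦ Γ ▸ adec x ρ X ⟧ ⊢ fv x ∶ erase X

  ⋆∶□ : (Γ : SnocCtx) → WellFormed Γ → ⟦ Γ ⟧ ⊢ srt star ∶ srt box
  ⋆∶□ ∅ _ = t-axiom
  ⋆∶□ (Γ ▸ adec x ρ X) (w , ⊢d) = t-weak {Δ = ⟦ Γ ⟧} ⊢d (⋆∶□ Γ w)

  lookupVar : (Γ : SnocCtx) → WellFormed Γ → (y : Var) → Maybe (Σ Term (⟦ Γ ⟧ ⊢ fv y ∶_))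
  lookupVar ∅ _ y = nothing
  lookupVar (Γ ▸ adec x ρ X) (w , ⊢d) y with y ≟ᵛ x
  ... | yes refl = just (erase X , ⊢d)
  ... | no _ = do
    T , ⊢y ← lookupVar Γ w y
    just (T , t-weak {Δ = ⟦ Γ ⟧} ⊢d ⊢y)

  satisfiesIfRestricted? : (Δ : Ctx) (W : Term) (ρ : List Term) → Maybe (ρ ≢ [] → rdec Δ ⊩ W ∈̄ ρ)
  satisfiesIfRestricted? Δ W [] = just (λ []≢[] → ⊥-elim ([]≢[] refl))
  satisfiesIfRestricted? Δ W ρ = Maybe.map const (satisfies? fuel (length (rdec Δ)) (rdec Δ) W ρ)

  sortOf : ∀ {Δ M} → Σ Term (Δ ⊢ M ∶_) → Maybe (Σ Sort (λ s → Δ ⊢ M ∶ srt s))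
  sortOf (srt s , ⊢M) = just (s , ⊢M)
  sortOf _ = nothing

  mutual
    infer : (Γ : SnocCtx) → WellFormed Γ → (M : ATerm) → Maybe (Σ Term (⟦ Γ ⟧ ⊢ erase M ∶_))
    infer Γ w (asrt star) = just (srt box , ⋆∶□ Γ w)
    infer Γ w (asrt box) = nothing
    infer Γ w (afv y) = lookupVar Γ w y
    infer Γ w (api x ρ X Y) = do
      s , ⊢Π ← inferPi Γ w x ρ X Y
      just (srt s , ⊢Π)
    infer Γ w (alam x ρ X M T) = do
      ⊢x ← start Γ w x ρ X
      ⊢M ← check (Γ ▸ adec x ρ X) (w , ⊢x) M (erase T)
      _ , ⊢Π ← inferPi Γ w x ρ X T
      reopensM , freshM ← bindable? x (erase M)
      reopensT , freshT ← bindable? x (erase T)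
      just (_ , t-lam freshM freshT
                  (subst₂ (⟦ Γ ▸ adec x ρ X ⟧ ⊢_∶_) (sym reopensM) (sym reopensT) ⊢M) ⊢Π)
    infer Γ w (aapp Z W) = do
      bind pi s ρ X Y , ⊢Z ← infer Γ w Z
        where _ → nothing
      ⊢W ← check Γ w W X
      sat ← satisfiesIfRestricted? ⟦ Γ ⟧ (erase W) ρ
      just (inst Y (erase W) , t-app ⊢Z ⊢W sat)
    infer Γ w (acast M T) = do
      T₀ , ⊢M ← infer Γ w M
      _ , ⊢T ← inferSort Γ w T
      conv ← satisfies? fuel (length (rdec ⟦ Γ ⟧)) (rdec ⟦ Γ ⟧) T₀ [ erase T ]
      just (erase T , t-conv ⊢M ⊢T conv)

    inferSort : (Γ : SnocCtx) → WellFormed Γ → (M : ATerm)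
              → Maybe (Σ Sort (λ s → ⟦ Γ ⟧ ⊢ erase M ∶ srt s))
    inferSort Γ w M = infer Γ w M >>= sortOf

    inferPi : (Γ : SnocCtx) → WellFormed Γ → (x : Var) (ρ : List ATerm) (X Y : ATerm)
            → Maybe (Σ Sort (λ s → ⟦ Γ ⟧ ⊢ erase (api x ρ X Y) ∶ srt s))
    inferPi Γ w x ρ X Y = do
      s′ , ⊢X ← inferSort Γ w X
      ⊢x ← start Γ w x ρ X
      s , ⊢Y ← inferSort (Γ ▸ adec x ρ X) (w , ⊢x) Y
      rule ← R? s′ s
      reopens , fresh ← bindable? x (erase Y)
      just (s , t-pi fresh (subst (λ t → ⟦ Γ ▸ adec x ρ X ⟧ ⊢ t ∶ srt s) (sym reopens) ⊢Y) ⊢X rule)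

    check : (Γ : SnocCtx) → WellFormed Γ → (M : ATerm) (T : Term) → Maybe (⟦ Γ ⟧ ⊢ erase M ∶ T)
    check Γ w M T = do
      T₀ , ⊢M ← infer Γ w M
      refl ← T₀ ≟ᵗ T
      just ⊢M

    checkAll : (Γ : SnocCtx) → WellFormed Γ → (ρ : List ATerm) (X : Term)
             → Maybe (∀ {Y} → Y ∈ erases ρ → ⟦ Γ ⟧ ⊢ Y ∶ X)
    checkAll Γ w [] X = just λ ()
    checkAll Γ w (a ∷ as) X = do
      ⊢a ← check Γ w a X
      ⊢as ← checkAll Γ w as X
      just λ { (here refl) → ⊢a ; (there Y∈as) → ⊢as Y∈as }

    start : (Γ : SnocCtx) → WellFormed Γ → (x : Var) (ρ : List ATerm) (X : ATerm)
          → Maybe (⟦ Γ ▸ adec x ρ X ⟧ ⊢ fv x ∶ erase X)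
    start Γ w (s , n) ρ X = do
      fresh ← (s , n) ∉?ᵛ dom ⟦ Γ ⟧
      s′ , ⊢X ← inferSort Γ w X
      refl ← dec⇒maybe (s′ ≟ˢ s)
      ⊢ρ ← checkAll Γ w ρ (erase X)
      just (t-start {Δ = ⟦ Γ ⟧} fresh ⊢X ⊢ρ)

  wellFormed? : (Γ : SnocCtx) → Maybe (WellFormed Γ)
  wellFormed? ∅ = just tt
  wellFormed? (Γ ▸ adec x ρ X) = do
    w ← wellFormed? Γ
    ⊢x ← start Γ w x ρ X
    just (w , ⊢x)

mutual
  maxName : ATerm → ℕ
  maxName (asrt s) = 0
  maxName (afv (s , n)) = n
  maxName (api (s , n) ρ X Y) = n ⊔ maxNames ρ ⊔ maxName X ⊔ maxName Y
  maxName (alam (s , n) ρ X M T) = n ⊔ maxNames ρ ⊔ maxName X ⊔ maxName M ⊔ maxName T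
  maxName (aapp M N) = maxName M ⊔ maxName N
  maxName (acast M T) = maxName M ⊔ maxName T

  maxNames : List ATerm → ℕ
  maxNames [] = 0
  maxNames (t ∷ ts) = maxName t ⊔ maxNames ts

-- The bound name exceeds every name in A and B and every variable name of the term
-- (all < 100), so it is fresh wherever the arrow is opened.
arrow : Sort → ATerm → ATerm → ATerm
arrow s A B = api (s , 100 + suc (maxName A ⊔ maxName B)) [] A B

infixr 5 _⇒_ _⇒ᵏ_
infixl 7 _·_

_⇒_ _⇒ᵏ_ _·_ : ATerm → ATerm → ATerm
_⇒_ = arrow star
_⇒ᵏ_ = arrow box
_·_ = aapp

⋆ : ATerm
⋆ = asrt star

‵_ : Var → ATerm
‵_ = afv

h c r α o β γ f s x y : Var
h = star , 0
c = box , 1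
r = star , 2
α = box , 3
o = star , 4
β = box , 5
γ = box , 6
f = star , 7
s = star , 8
x = box , 20
y = box , 21

κ : ATerm
κ = ⋆ ⇒ᵏ ⋆ ⇒ᵏ ⋆

K₁ K₂ : ATerm
K₁ = alam x [] ⋆ (alam y [] ⋆ (‵ x) ⋆) (⋆ ⇒ᵏ ⋆)
K₂ = alam x [] ⋆ (alam y [] ⋆ (‵ y) ⋆) (⋆ ⇒ᵏ ⋆)

AppTy RevAppTy : ATerm → ATerm → ATerm
AppTy B C = (B ⇒ C) ⇒ B ⇒ C
RevAppTy B C = B ⇒ (B ⇒ C) ⇒ C

Πβγ : ATerm → ATerm
Πβγ T = api β [] ⋆ (api γ [] ⋆ T)

Λβγ : ATerm → ATerm → ATerm
Λβγ M T = alam β [] ⋆ (alam γ [] ⋆ M T) (api γ [] ⋆ T)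

app-comb rev-app-comb : ATerm
app-comb = Λβγ (alam f [] (‵ β ⇒ ‵ γ) (alam s [] (‵ β) (‵ f · ‵ s) (‵ γ)) (‵ β ⇒ ‵ γ))
               (AppTy (‵ β) (‵ γ))
rev-app-comb = Λβγ (alam f [] (‵ β) (alam s [] (‵ β ⇒ ‵ γ) (‵ s · ‵ f) (‵ γ)) ((‵ β ⇒ ‵ γ) ⇒ ‵ γ))
                   (RevAppTy (‵ β) (‵ γ))

OTy : ATerm → ATerm
OTy A = Πβγ (A · AppTy (‵ β) (‵ γ) · RevAppTy (‵ β) (‵ γ))

-- ⟨ A ∣ B ⟩ is A when α := K₁ and B when α := K₂.
⟨_∣_⟩ : ATerm → ATerm → ATerm
⟨ A ∣ B ⟩ = ‵ α · A · B

D₁ T₁ D₂ T₂ : ATerm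
D₁ = ‵ c ⇒ ‵ c
T₁ = D₁ ⇒ D₁
D₂ = RevAppTy (‵ c) (‵ c)
T₂ = (D₂ ⇒ ‵ c) ⇒ ‵ c

RTy HTy : ATerm
RTy = api α (K₁ ∷ K₂ ∷ []) κ (OTy (‵ α) ⇒ ⟨ T₁ ∣ T₂ ⟩)
HTy = T₁ ⇒ T₂ ⇒ ‵ c

ooo : ATerm
ooo = acast (‵ o · ⟨ T₁ ∣ D₂ ⟩ · ⟨ T₁ ∣ T₂ ⟩) (⟨ T₁ ⇒ T₁ ∣ D₂ ⟩ ⇒ ⟨ T₁ ∣ D₂ ⇒ T₂ ⟩ ⇒ ⟨ T₁ ∣ T₂ ⟩)
    · acast (‵ o · ⟨ D₁ ∣ ‵ c ⟩ · ⟨ D₁ ∣ ‵ c ⟩) ⟨ T₁ ⇒ T₁ ∣ D₂ ⟩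
    · acast (‵ o · ⟨ ‵ c ∣ D₂ ⟩ · ⟨ ‵ c ∣ ‵ c ⟩) ⟨ T₁ ∣ D₂ ⇒ T₂ ⟩

urzyczyn : ATerm
urzyczyn = alam r [] RTy (‵ h · r-at K₁ app-comb T₁ · r-at K₂ rev-app-comb T₂) (‵ c) · self-app
  where
  r-at : ATerm → ATerm → ATerm → ATerm
  r-at K comb T = acast (‵ r · K · acast comb (OTy K)) T
  self-app : ATerm
  self-app = alam α (K₁ ∷ K₂ ∷ []) κ (alam o [] (OTy (‵ α)) ooo ⟨ T₁ ∣ T₂ ⟩)
                  (OTy (‵ α) ⇒ ⟨ T₁ ∣ T₂ ⟩)

Γ₀ : SnocCtx
Γ₀ = ∅ ▸ adec c [] ⋆ ▸ adec h [] HTy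

mainTheorem5 : (R : Sort → Sort → Set) → R star star → R box box → R box star →
    Σ Ctx (λ Δ → Σ Term (λ A → Σ Term (λ B →
      Typing._⊢_∶_ R Δ A B × Typing._⊢_∶_ R Δ B (srt star) × TE A ≡ just U)))
mainTheorem5 R ⋆⋆ □□ □⋆ =
  ⟦ Γ₀ ⟧ , erase urzyczyn , fv c ,
  from-just (check Γ₀ w₀ urzyczyn (fv c)) , from-just (check Γ₀ w₀ (‵ c) (srt star)) , refl
  where
  R? : (s s′ : Sort) → Maybe (R s s′)
  R? star star = just ⋆⋆
  R? box  box  = just □□
  R? box  star = just □⋆
  R? star box  = nothing
  open Checker R R? 50
  w₀ : WellFormed Γ₀
  w₀ = from-just (wellFormed? Γ₀)
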